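{- For any instance of \textsc{Best Response} (defined in the context) with an additive utility function of the manipulator, if the manipulator uses its truthful preference ranking $\succ_1$ as its picking strategy, it obtains a bundle whose total utility is at least half of the total utility of the bundle obtained under an optimal picking strategy.
   Context: Sequential allocation: a set $O$ of $m$ indivisible items is allocated to agents $N=\{1,\dots,n\}$ according to a policy $\pi$, a sequence of agents of length $m$. Each agent $i$ has a strict complete preference ranking $\succ_i$ over $O$. Agent 1 is the manipulator and has an additive utility function $u:O\to\mathbb{R}_{>0}$ consistent with $\succ_1$ (i.e. $u(g_x)>u(g_y)$ iff $g_x\succ_1 g_y$). Items are allocated in turns following $\pi$: at a turn of a non-manipulator $i\ge 2$, it takes its most preferred (under $\succ_i$) item not yet allocated. The manipulator uses a picking strategy, i.e. a permutation of $O$, and at each of its turns it takes the first item of this permutation not yet allocated. \textsc{Best Response} asks for a picking strategy maximizing the manipulator's total utility; an optimal picking strategy is one attaining this maximum.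
   Formalization: The manipulator's additive utility u takes positive rational values rather than positive real values. -}

module Defs where

open import Data.Nat using (ℕ)
open import Data.Fin using (Fin; _≟_)
open import Data.List using (List; []; _∷_; allFin)
open import Data.Vec using (Vec; []; _∷_)
open import Data.Maybe using (Maybe; just; nothing)
open import Data.Product using (_×_)
open import Data.Rational using (ℚ; 0ℚ; _+_; _≤_)
open import Data.Bool using (Bool; true; false; _∨_)
open import Data.List.Relation.Binary.Permutation.Propositional using (_↭_)
open import Relation.Nullary using (does)

-- Agents N = {1,...,n} with n = suc k: the manipulator (agent 1) and the
-- k non-manipulators (agents 2..n), indexed by Fin k.
data Agent (k : ℕ) : Set where
  manipulator : Agent k
  other       : Fin k → Agent k

-- A strict complete ranking over O = Fin m, and also a picking strategy,
-- is a permutation of O, listed from most to least preferred.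
IsRanking : ∀ {m} → List (Fin m) → Set
IsRanking {m} σ = σ ↭ allFin m

isTaken : ∀ {m} → Fin m → List (Fin m) → Bool
isTaken x []       = false
isTaken x (y ∷ ys) = does (x ≟ y) ∨ isTaken x ys

firstFree : ∀ {m} → List (Fin m) → List (Fin m) → Maybe (Fin m)
firstFree []       taken = nothing
firstFree (x ∷ xs) taken with isTaken x taken
... | true  = firstFree xs taken
... | false = just x

listOf : ∀ {k m} → List (Fin m) → (Fin k → List (Fin m)) → Agent k → List (Fin m)
listOf σ prefs manipulator = σ
listOf σ prefs (other j)   = prefs j

addIfManip : ∀ {k m} → Agent k → Fin m → List (Fin m) → List (Fin m)
addIfManip manipulator x b = x ∷ b
addIfManip (other _)   x b = b

run : ∀ {k m l} → Vec (Agent k) l → List (Fin m) → (Fin k → List (Fin m))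
    → List (Fin m) → List (Fin m)
run []      σ prefs taken = []
run (a ∷ π) σ prefs taken with firstFree (listOf σ prefs a) taken
... | nothing = run π σ prefs taken
... | just x  = addIfManip a x (run π σ prefs (x ∷ taken))

bundle : ∀ {k m} → Vec (Agent k) m → (Fin k → List (Fin m)) → List (Fin m) → List (Fin m)
bundle π prefs σ = run π σ prefs []

utility : ∀ {m} → (Fin m → ℚ) → List (Fin m) → ℚ
utility u []      = 0ℚ
utility u (o ∷ b) = u o + utility u b

value : ∀ {k m} → Vec (Agent k) m → (Fin k → List (Fin m)) → (Fin m → ℚ) → List (Fin m) → ℚ
value π prefs u σ = utility u (bundle π prefs σ)

Optimal : ∀ {k m} → Vec (Agent k) m → (Fin k → List (Fin m)) → (Fin m → ℚ) → List (Fin m) → Set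
Optimal π prefs u σ =
  IsRanking σ × (∀ σ′ → IsRanking σ′ → value π prefs u σ′ ≤ value π prefs u σ)

{-# OPTIONS --safe #-}
-- Fix a prefix P of the truthful ranking and run the allocation under an arbitrary strategy σ
-- and under the truthful one side by side. Let D be the number of items already allocated in
-- the truthful run but not yet in the σ-run. A turn of another agent never increases D. While P
-- is not exhausted in the truthful run, each manipulator turn gives the truthful bundle an item
-- of P and the σ-bundle at most one, and increases D by at most one; once P is exhausted, σ can
-- still obtain at most D items of P. So the σ-bundle contains at most twice as many items of P
-- as the truthful bundle. Abel summation along the truthful ranking, whose consecutive utility
-- gaps are nonnegative, turns these counts into the utility bound.
module Submission where

open import Defs
open import Algebra.Bundles using (CommutativeMonoid)
open import Data.Bool using (Bool; true; false; _∨_; _∧_; not; if_then_else_)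
open import Data.Bool.Properties using (∨-assoc; ∨-zeroʳ; ∧-zeroʳ; ∧-identityʳ)
open import Data.Fin using (Fin; zero; suc; _≟_; punchIn)
open import Data.Fin.Properties using (punchInᵢ≢i)
open import Data.List using (List; []; _∷_; _++_; _∷ʳ_)
open import Data.List.Properties using (++-assoc; ++-identityʳ)
open import Data.List.Membership.Propositional using (_∈_)
open import Data.List.Membership.Propositional.Properties using (∈-allFin)
open import Data.List.Relation.Unary.Any using (here; there)
open import Data.List.Relation.Unary.Linked as Linked using (Linked; _∷_)
open import Data.List.Relation.Binary.Permutation.Propositional using (↭-sym)
open import Data.List.Relation.Binary.Permutation.Propositional.Properties using (∈-resp-↭)
open import Data.Maybe using (just; nothing; maybe′)
open import Data.Product using (_×_; _,_)
open import Data.Nat.Base as ℕ using (ℕ; zero; suc; z≤n; s≤s)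
import Data.Nat.Properties as ℕ
open import Data.Rational using (ℚ; 0ℚ; _+_; _-_; -_; _<_; _≤_)
open import Data.Rational.Solver using (module +-*-Solver)
import Data.Rational.Properties as ℚ
open import Data.Vec using (Vec; []; _∷_)
open import Function using (_∘_)
open import Relation.Binary.PropositionalEquality
open import Relation.Nullary using (does; yes; no; contradiction)
open import Relation.Nullary.Decidable using (dec-true; dec-false)

open import Algebra.Properties.CommutativeMonoid.Sum ℕ.+-0-commutativeMonoid
  using (sum; sum-remove; sum-cong-≗; sum-replicate-zero)
open import Algebra.Properties.Monoid.Mult ℚ.+-0-monoid using (×-homo-+) renaming (_×_ to _·_)
open import Algebra.Properties.CommutativeSemigroup ℕ.+-commutativeSemigroup using (xy∙z≈zy∙x)
open import Algebra.Properties.CommutativeSemigroup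
  (CommutativeMonoid.commutativeSemigroup ℚ.+-0-commutativeMonoid) using (interchange)

𝟙[_] : Bool → ℕ
𝟙[ true  ] = 1
𝟙[ false ] = 0

𝟙≤1 : ∀ b → 𝟙[ b ] ℕ.≤ 1
𝟙≤1 true  = ℕ.≤-refl
𝟙≤1 false = z≤n

sum-mono-≤ : ∀ {n} {f g : Fin n → ℕ} → (∀ i → f i ℕ.≤ g i) → sum f ℕ.≤ sum g
sum-mono-≤ {zero}  f≤g = z≤n
sum-mono-≤ {suc n} f≤g = ℕ.+-mono-≤ (f≤g zero) (sum-mono-≤ (f≤g ∘ suc))

sum-exchange : ∀ {n} (f g : Fin n → ℕ) y → (∀ i → i ≢ y → f i ≡ g i)
             → sum f ℕ.+ g y ≡ sum g ℕ.+ f y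
sum-exchange {suc n} f g y f≡g = begin
  sum f ℕ.+ g y                             ≡⟨ cong (ℕ._+ g y) (sum-remove {i = y} f) ⟩
  (f y ℕ.+ sum (f ∘ punchIn y)) ℕ.+ g y     ≡⟨ cong (λ s → (f y ℕ.+ s) ℕ.+ g y) rest ⟩
  (f y ℕ.+ sum (g ∘ punchIn y)) ℕ.+ g y     ≡⟨ xy∙z≈zy∙x (f y) _ (g y) ⟩
  (g y ℕ.+ sum (g ∘ punchIn y)) ℕ.+ f y     ≡⟨ cong (ℕ._+ f y) (sum-remove {i = y} g) ⟨
  sum g ℕ.+ f y                             ∎
  where
  open ≡-Reasoning
  rest : sum (f ∘ punchIn y) ≡ sum (g ∘ punchIn y)
  rest = sum-cong-≗ (λ i → f≡g (punchIn y i) (punchInᵢ≢i y i))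

isTaken-head : ∀ {m} (y : Fin m) S → isTaken y (y ∷ S) ≡ true
isTaken-head y S rewrite dec-true (y ≟ y) refl = refl

isTaken-∷ : ∀ {m} {o y : Fin m} S → o ≢ y → isTaken o (y ∷ S) ≡ isTaken o S
isTaken-∷ {o = o} {y} S o≢y rewrite dec-false (o ≟ y) o≢y = refl

isTaken-++ : ∀ {m} (x : Fin m) A B → isTaken x (A ++ B) ≡ isTaken x A ∨ isTaken x B
isTaken-++ x []      B = refl
isTaken-++ x (a ∷ A) B =
  trans (cong (does (x ≟ a) ∨_) (isTaken-++ x A B)) (sym (∨-assoc (does (x ≟ a)) _ _))

∈⇒isTaken : ∀ {m} {x : Fin m} {L} → x ∈ L → isTaken x L ≡ true
∈⇒isTaken {x = x} {L = y ∷ L} (here refl) = isTaken-head x L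
∈⇒isTaken {x = x} {L = y ∷ L} (there x∈L) =
  trans (cong (does (x ≟ y) ∨_) (∈⇒isTaken x∈L)) (∨-zeroʳ _)

isTaken-∷⁻ : ∀ {m} {o y : Fin m} S → isTaken o (y ∷ S) ≡ false
           → o ≢ y × isTaken o S ≡ false
isTaken-∷⁻ {o = o} {y} S o∉y∷S with o ≟ y | o∉y∷S
... | no o≢y | o∉S = o≢y , o∉S

firstFree-free : ∀ {m} L (S : List (Fin m)) {x} → firstFree L S ≡ just x → isTaken x S ≡ false
firstFree-free (z ∷ L) S eq with isTaken z S in z∈S
... | true  = firstFree-free L S eq
firstFree-free (z ∷ L) S refl | false = z∈S

firstFree-chosen : ∀ {m} L (S : List (Fin m)) {x} → firstFree L S ≡ just x → isTaken x L ≡ true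
firstFree-chosen (z ∷ L) S {x} eq with isTaken z S
... | true  = trans (cong (does (x ≟ z) ∨_) (firstFree-chosen L S eq)) (∨-zeroʳ _)
firstFree-chosen (z ∷ L) S refl | false = isTaken-head z L

firstFree-nothing : ∀ {m} L (S : List (Fin m)) {o} → firstFree L S ≡ nothing
                  → isTaken o L ≡ true → isTaken o S ≡ true
firstFree-nothing (z ∷ L) S {o} eq o∈L with isTaken z S in z∈S | o ≟ z
... | true  | yes refl = z∈S
... | true  | no o≢z  = firstFree-nothing L S eq o∈L
... | false | _       with eq
...   | ()

firstFree-++ : ∀ {m} P R (S : List (Fin m)) {x} → firstFree P S ≡ just x
             → firstFree (P ++ R) S ≡ just x
firstFree-++ (z ∷ P) R S eq with isTaken z S
... | true  = firstFree-++ P R S eq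
... | false = eq

-- y′ precedes y in L, so the scan from T, which stopped at y, found y′ already taken.
firstFree-earlier : ∀ {m} L (S T : List (Fin m)) {y y′}
                  → firstFree L S ≡ just y′ → firstFree L T ≡ just y
                  → isTaken y S ≡ false → y ≢ y′ → isTaken y′ T ≡ true
firstFree-earlier (z ∷ L) S T eqS eqT y∉S y≢y′ with isTaken z T in z∈T | isTaken z S in z∈S
... | true  | true  = firstFree-earlier L S T eqS eqT y∉S y≢y′
firstFree-earlier (z ∷ L) S T refl eqT y∉S y≢y′ | true | false = z∈T
firstFree-earlier (z ∷ L) S T eqS refl y∉S y≢y′ | false | true with trans (sym z∈S) y∉S
... | ()
firstFree-earlier (z ∷ L) S T refl refl y∉S y≢y′ | false | false = contradiction refl y≢y′

afterTurn : ∀ {m} → List (Fin m) → List (Fin m) → List (Fin m)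
afterTurn L S = maybe′ (_∷ S) S (firstFree L S)

run-other : ∀ {k m l} (π : Vec (Agent k) l) σ (prefs : Fin k → List (Fin m)) j S
          → run (other j ∷ π) σ prefs S ≡ run π σ prefs (afterTurn (prefs j) S)
run-other π σ prefs j S with firstFree (prefs j) S
... | nothing = refl
... | just _  = refl

∣_∖_∣ : ∀ {m} → List (Fin m) → List (Fin m) → ℕ
∣_∖_∣ {m} T S = sum {m} λ o → 𝟙[ isTaken o T ∧ not (isTaken o S) ]

∖-emptyˡ : ∀ {m} (S : List (Fin m)) → ∣ [] ∖ S ∣ ≡ 0
∖-emptyˡ {m} S = sum-replicate-zero m

∖-consˡ : ∀ {m} T S (y : Fin m)
        → ∣ y ∷ T ∖ S ∣ ℕ.+ 𝟙[ isTaken y T ∧ not (isTaken y S) ]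
        ≡ ∣ T ∖ S ∣ ℕ.+ 𝟙[ not (isTaken y S) ]
∖-consˡ T S y
  rewrite sum-exchange _ _ y (λ o o≢y → cong (λ b → 𝟙[ b ∧ not (isTaken o S) ]) (isTaken-∷ T o≢y))
        | isTaken-head y T = refl

∖-consʳ : ∀ {m} T S (y : Fin m)
        → ∣ T ∖ y ∷ S ∣ ℕ.+ 𝟙[ isTaken y T ∧ not (isTaken y S) ] ≡ ∣ T ∖ S ∣
∖-consʳ T S y
  rewrite sum-exchange _ _ y (λ o o≢y → cong (λ b → 𝟙[ isTaken o T ∧ not b ]) (isTaken-∷ S o≢y))
        | isTaken-head y S | ∧-zeroʳ (isTaken y T) = ℕ.+-identityʳ _

∖-antitoneʳ : ∀ {m} T S (y : Fin m) → ∣ T ∖ y ∷ S ∣ ℕ.≤ ∣ T ∖ S ∣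
∖-antitoneʳ T S y = subst (∣ T ∖ y ∷ S ∣ ℕ.≤_) (∖-consʳ T S y) (ℕ.m≤m+n _ _)

∖-consʳ-free : ∀ {m} T S (y : Fin m) → isTaken y S ≡ false
             → 𝟙[ isTaken y T ] ℕ.+ ∣ T ∖ y ∷ S ∣ ≡ ∣ T ∖ S ∣
∖-consʳ-free T S y y∉S = begin
  𝟙[ isTaken y T ] ℕ.+ ∣ T ∖ y ∷ S ∣                      ≡⟨ ℕ.+-comm _ ∣ T ∖ y ∷ S ∣ ⟩
  ∣ T ∖ y ∷ S ∣ ℕ.+ 𝟙[ isTaken y T ]                      ≡⟨ cong (λ b → ∣ T ∖ y ∷ S ∣ ℕ.+ 𝟙[ b ]) y-fresh ⟨
  ∣ T ∖ y ∷ S ∣ ℕ.+ 𝟙[ isTaken y T ∧ not (isTaken y S) ]  ≡⟨ ∖-consʳ T S y ⟩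
  ∣ T ∖ S ∣                                              ∎
  where
  open ≡-Reasoning
  y-fresh : isTaken y T ∧ not (isTaken y S) ≡ isTaken y T
  y-fresh = trans (cong (λ b → isTaken y T ∧ not b) y∉S) (∧-identityʳ _)

∖-consˡ-≤ : ∀ {m} T S (y : Fin m) → ∣ y ∷ T ∖ S ∣ ℕ.≤ suc ∣ T ∖ S ∣
∖-consˡ-≤ T S y = begin
  ∣ y ∷ T ∖ S ∣                                           ≤⟨ ℕ.m≤m+n _ _ ⟩
  ∣ y ∷ T ∖ S ∣ ℕ.+ 𝟙[ isTaken y T ∧ not (isTaken y S) ]  ≡⟨ ∖-consˡ T S y ⟩
  ∣ T ∖ S ∣ ℕ.+ 𝟙[ not (isTaken y S) ]                    ≤⟨ ℕ.+-monoʳ-≤ _ (𝟙≤1 _) ⟩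
  ∣ T ∖ S ∣ ℕ.+ 1                                         ≡⟨ ℕ.+-comm _ 1 ⟩
  suc ∣ T ∖ S ∣                                           ∎
  where open ℕ.≤-Reasoning

∖-consˡ-taken : ∀ {m} T S (y : Fin m) → isTaken y S ≡ true
              → ∣ y ∷ T ∖ S ∣ ℕ.≤ ∣ T ∖ S ∣
∖-consˡ-taken T S y y∈S = begin
  ∣ y ∷ T ∖ S ∣                                           ≤⟨ ℕ.m≤m+n _ _ ⟩
  ∣ y ∷ T ∖ S ∣ ℕ.+ 𝟙[ isTaken y T ∧ not (isTaken y S) ]  ≡⟨ ∖-consˡ T S y ⟩
  ∣ T ∖ S ∣ ℕ.+ 𝟙[ not (isTaken y S) ]                    ≡⟨ cong (λ b → ∣ T ∖ S ∣ ℕ.+ 𝟙[ not b ]) y∈S ⟩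
  ∣ T ∖ S ∣ ℕ.+ 0                                         ≡⟨ ℕ.+-identityʳ _ ⟩
  ∣ T ∖ S ∣                                               ∎
  where open ℕ.≤-Reasoning

∖-monoˡ : ∀ {m} {P T : List (Fin m)} S → (∀ o → isTaken o P ≡ true → isTaken o T ≡ true)
        → ∣ P ∖ S ∣ ℕ.≤ ∣ T ∖ S ∣
∖-monoˡ {P = P} {T} S P⊆T = sum-mono-≤ pointwise
  where
  pointwise : ∀ o → 𝟙[ isTaken o P ∧ not (isTaken o S) ]
                ℕ.≤ 𝟙[ isTaken o T ∧ not (isTaken o S) ]
  pointwise o with isTaken o P in o∈P
  ... | false = z≤n
  ... | true rewrite P⊆T o o∈P = ℕ.≤-refl

∖-afterTurnʳ : ∀ {m} T L (S : List (Fin m)) → ∣ T ∖ afterTurn L S ∣ ℕ.≤ ∣ T ∖ S ∣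
∖-afterTurnʳ T L S with firstFree L S
... | nothing = ℕ.≤-refl
... | just y′ = ∖-antitoneʳ T S y′

∖-afterTurn : ∀ {m} L (T S : List (Fin m)) → (∀ o → isTaken o L ≡ true)
            → ∣ afterTurn L T ∖ afterTurn L S ∣ ℕ.≤ ∣ T ∖ S ∣
∖-afterTurn L T S complete with firstFree L T in eqT | firstFree L S in eqS
... | nothing | nothing = ℕ.≤-refl
... | nothing | just y′ = ∖-antitoneʳ T S y′
... | just y  | nothing = ∖-consˡ-taken T S y (firstFree-nothing L S eqS (complete y))
... | just y  | just y′ with isTaken y (y′ ∷ S) in y∈S′
...   | true  = ℕ.≤-trans (∖-consˡ-taken T (y′ ∷ S) y y∈S′) (∖-antitoneʳ T S y′)
...   | false = begin
  ∣ y ∷ T ∖ y′ ∷ S ∣                    ≤⟨ ∖-consˡ-≤ T (y′ ∷ S) y ⟩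
  suc ∣ T ∖ y′ ∷ S ∣                    ≡⟨ cong (λ b → 𝟙[ b ] ℕ.+ ∣ T ∖ y′ ∷ S ∣) y′∈T ⟨
  𝟙[ isTaken y′ T ] ℕ.+ ∣ T ∖ y′ ∷ S ∣  ≡⟨ ∖-consʳ-free T S y′ (firstFree-free L S eqS) ⟩
  ∣ T ∖ S ∣                             ∎
  where
  open ℕ.≤-Reasoning
  y′∈T : isTaken y′ T ≡ true
  y′∈T with isTaken-∷⁻ S y∈S′
  ... | y≢y′ , y∉S = firstFree-earlier L S T eqS eqT y∉S y≢y′

count : ∀ {m} → List (Fin m) → List (Fin m) → ℕ
count P []      = 0
count P (x ∷ X) = 𝟙[ isTaken x P ] ℕ.+ count P X

count-++ : ∀ {m} (P X Y : List (Fin m)) → count P (X ++ Y) ≡ count P X ℕ.+ count P Y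
count-++ P []      Y = refl
count-++ P (x ∷ X) Y =
  trans (cong (𝟙[ isTaken x P ] ℕ.+_) (count-++ P X Y)) (sym (ℕ.+-assoc 𝟙[ isTaken x P ] _ _))

module _ {k m} (prefs : Fin k → List (Fin m)) (P : List (Fin m)) where

  count-run-≤-∖ : ∀ {l} (π : Vec (Agent k) l) σ S
                → count P (run π σ prefs S) ℕ.≤ ∣ P ∖ S ∣
  count-run-≤-∖ []      σ S = z≤n
  count-run-≤-∖ (other j ∷ π) σ S rewrite run-other π σ prefs j S =
    ℕ.≤-trans (count-run-≤-∖ π σ _) (∖-afterTurnʳ P (prefs j) S)
  count-run-≤-∖ (manipulator ∷ π) σ S with firstFree σ S in eq
  ... | nothing = count-run-≤-∖ π σ S
  ... | just x  = ℕ.≤-trans (ℕ.+-monoʳ-≤ 𝟙[ isTaken x P ] (count-run-≤-∖ π σ (x ∷ S)))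
                            (ℕ.≤-reflexive (∖-consʳ-free P S x (firstFree-free σ S eq)))

  count-run-manipulator-≤ : ∀ {l} (π : Vec (Agent k) l) σ S
    → count P (run (manipulator ∷ π) σ prefs S)
      ℕ.≤ suc (count P (run π σ prefs (afterTurn σ S)))
  count-run-manipulator-≤ π σ S with firstFree σ S
  ... | nothing = ℕ.n≤1+n _
  ... | just x  = ℕ.+-monoˡ-≤ _ (𝟙≤1 (isTaken x P))

  count-run-≤-truthful : (∀ j o → isTaken o (prefs j) ≡ true)
    → ∀ R {l} (π : Vec (Agent k) l) σ T S
    → count P (run π σ prefs S) ℕ.≤ 2 ℕ.* count P (run π (P ++ R) prefs T) ℕ.+ ∣ T ∖ S ∣
  count-run-≤-truthful complete R []      σ T S = z≤n
  count-run-≤-truthful complete R (other j ∷ π) σ T S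
    rewrite run-other π σ prefs j S | run-other π (P ++ R) prefs j T =
    ℕ.≤-trans (count-run-≤-truthful complete R π σ _ _)
              (ℕ.+-monoʳ-≤ _ (∖-afterTurn (prefs j) T S (complete j)))
  -- The truthful manipulator picks from P until P is exhausted in T.
  count-run-≤-truthful complete R (manipulator ∷ π) σ T S with firstFree P T in eq
  ... | nothing = begin
    count P (run (manipulator ∷ π) σ prefs S)  ≤⟨ count-run-≤-∖ (manipulator ∷ π) σ S ⟩
    ∣ P ∖ S ∣                                  ≤⟨ ∖-monoˡ {P = P} {T} S (λ o → firstFree-nothing P T eq) ⟩
    ∣ T ∖ S ∣                                  ≤⟨ ℕ.m≤n+m _ _ ⟩
    2 ℕ.* count P (run (manipulator ∷ π) (P ++ R) prefs T) ℕ.+ ∣ T ∖ S ∣ ∎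
    where open ℕ.≤-Reasoning
  ... | just t
    rewrite firstFree-++ P R T eq | firstFree-chosen P T eq = begin
    count P (run (manipulator ∷ π) σ prefs S)      ≤⟨ count-run-manipulator-≤ π σ S ⟩
    suc (count P (run π σ prefs (afterTurn σ S)))  ≤⟨ s≤s (count-run-≤-truthful complete R π σ _ _) ⟩
    suc (2 ℕ.* g ℕ.+ ∣ t ∷ T ∖ afterTurn σ S ∣)    ≤⟨ s≤s (ℕ.+-monoʳ-≤ (2 ℕ.* g) D-grows-by-≤1) ⟩
    suc (2 ℕ.* g ℕ.+ suc ∣ T ∖ S ∣)                ≡⟨ cong suc (ℕ.+-suc (2 ℕ.* g) _) ⟩
    2 ℕ.+ 2 ℕ.* g ℕ.+ ∣ T ∖ S ∣                    ≡⟨ cong (ℕ._+ ∣ T ∖ S ∣) (ℕ.*-suc 2 g) ⟨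
    2 ℕ.* suc g ℕ.+ ∣ T ∖ S ∣                      ∎
    where
    open ℕ.≤-Reasoning
    g : ℕ
    g = count P (run π (P ++ R) prefs (t ∷ T))
    D-grows-by-≤1 : ∣ t ∷ T ∖ afterTurn σ S ∣ ℕ.≤ suc ∣ T ∖ S ∣
    D-grows-by-≤1 = ℕ.≤-trans (∖-afterTurnʳ (t ∷ T) σ S) (∖-consˡ-≤ T S t)

prefix-count-≤ : ∀ {k m} (π : Vec (Agent k) m) prefs → (∀ j o → isTaken o (prefs j) ≡ true)
  → ∀ σ P R {truth} → P ++ R ≡ truth
  → count P (bundle π prefs σ) ℕ.≤ count P (bundle π prefs truth ++ bundle π prefs truth)
prefix-count-≤ {m = m} π prefs complete σ P R refl = begin
  count P (run π σ prefs [])   ≤⟨ count-run-≤-truthful prefs P complete R π σ [] [] ⟩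
  2 ℕ.* c ℕ.+ ∣_∖_∣ {m} [] []  ≡⟨ cong (2 ℕ.* c ℕ.+_) (∖-emptyˡ {m} []) ⟩
  2 ℕ.* c ℕ.+ 0                ≡⟨ ℕ.+-identityʳ _ ⟩
  c ℕ.+ (c ℕ.+ 0)              ≡⟨ cong (c ℕ.+_) (ℕ.+-identityʳ c) ⟩
  c ℕ.+ c                      ≡⟨ count-++ P truthful truthful ⟨
  count P (truthful ++ truthful) ∎
  where
  open ℕ.≤-Reasoning
  truthful : List (Fin m)
  truthful = run π (P ++ R) prefs []
  c : ℕ
  c = count P truthful

·-nonneg : ∀ {q} → 0ℚ ≤ q → ∀ n → 0ℚ ≤ n · q
·-nonneg q≥0 zero    = ℚ.≤-refl
·-nonneg q≥0 (suc n) = ℚ.+-mono-≤ q≥0 (·-nonneg q≥0 n)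

·-monoˡ-≤ : ∀ {q a b} → 0ℚ ≤ q → a ℕ.≤ b → a · q ≤ b · q
·-monoˡ-≤ q≥0 (z≤n {b})  = ·-nonneg q≥0 b
·-monoˡ-≤ {q} q≥0 (s≤s a≤b) = ℚ.+-monoʳ-≤ q (·-monoˡ-≤ q≥0 a≤b)

p≤q⇒0≤q-p : ∀ {p q} → p ≤ q → 0ℚ ≤ q - p
p≤q⇒0≤q-p {p} {q} p≤q = subst (_≤ q - p) (ℚ.+-inverseʳ p) (ℚ.+-monoˡ-≤ (- p) p≤q)

module _ {m} (u : Fin m → ℚ) where

  utility-++ : ∀ X Y → utility u (X ++ Y) ≡ utility u X + utility u Y
  utility-++ []      Y = sym (ℚ.+-identityˡ _)
  utility-++ (x ∷ X) Y = trans (cong (u x +_) (utility-++ X Y)) (sym (ℚ.+-assoc (u x) _ _))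

  top : List (Fin m) → ℚ
  top []      = 0ℚ
  top (o ∷ _) = u o

  gap : Fin m → List (Fin m) → ℚ
  gap o L = u o - top L

  valueFrom : List (Fin m) → List (Fin m) → Fin m → ℚ
  valueFrom acc L x = if isTaken x acc then top L else u x

  -- For L = o₁ … oₙ, abelSum [] L X = Σᵢ count [o₁ … oᵢ] X · (u oᵢ - u oᵢ₊₁) with u oₙ₊₁ = 0,
  -- which is utility u X by Abel summation.
  abelSum : List (Fin m) → List (Fin m) → List (Fin m) → ℚ
  abelSum acc []      X = 0ℚ
  abelSum acc (o ∷ L) X = count (acc ∷ʳ o) X · gap o L + abelSum (acc ∷ʳ o) L X

  gap-top : ∀ o L → 1 · gap o L + top L ≡ u o
  gap-top o L = solve 2 (λ a t → ((a :- t) :+ con 0ℚ) :+ t := a) refl (u o) (top L)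
    where open +-*-Solver

  valueFrom-step : ∀ acc o L x
    → 𝟙[ isTaken x (acc ∷ʳ o) ] · gap o L + valueFrom (acc ∷ʳ o) L x
    ≡ valueFrom acc (o ∷ L) x
  valueFrom-step acc o L x rewrite isTaken-++ x acc (o ∷ []) with isTaken x acc | x ≟ o
  ... | true  | _        = gap-top o L
  ... | false | yes refl = gap-top x L
  ... | false | no _     = ℚ.+-identityˡ (u x)

  abelSum-∷ : ∀ acc L x X → isTaken x (acc ++ L) ≡ true
            → abelSum acc L (x ∷ X) ≡ valueFrom acc L x + abelSum acc L X
  abelSum-∷ acc [] x X x∈acc++[]
    rewrite subst (λ A → isTaken x A ≡ true) (++-identityʳ acc) x∈acc++[] =
    sym (ℚ.+-identityʳ 0ℚ)
  abelSum-∷ acc (o ∷ L) x X x∈acc++L = begin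
    count acc′ (x ∷ X) · gap o L + abelSum acc′ L (x ∷ X)
      ≡⟨ cong₂ _+_ (×-homo-+ (gap o L) 𝟙[ isTaken x acc′ ] (count acc′ X))
                   (abelSum-∷ acc′ L x X x∈acc′++L) ⟩
    (new · gap o L + count acc′ X · gap o L) + (valueFrom acc′ L x + abelSum acc′ L X)
      ≡⟨ interchange (new · gap o L) (count acc′ X · gap o L) (valueFrom acc′ L x) _ ⟩
    (new · gap o L + valueFrom acc′ L x) + (count acc′ X · gap o L + abelSum acc′ L X)
      ≡⟨ cong (_+ _) (valueFrom-step acc o L x) ⟩
    valueFrom acc (o ∷ L) x + abelSum acc (o ∷ L) X ∎
    where
    open ≡-Reasoning
    acc′ : List (Fin m)
    acc′ = acc ∷ʳ o
    new : ℕ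
    new = 𝟙[ isTaken x acc′ ]
    x∈acc′++L : isTaken x (acc′ ++ L) ≡ true
    x∈acc′++L = subst (λ A → isTaken x A ≡ true) (sym (++-assoc acc (o ∷ []) L)) x∈acc++L

  abelSum-[] : ∀ acc L → abelSum acc L [] ≡ 0ℚ
  abelSum-[] acc []      = refl
  abelSum-[] acc (o ∷ L) = trans (ℚ.+-identityˡ _) (abelSum-[] (acc ∷ʳ o) L)

  utility≡abelSum : ∀ L → (∀ x → isTaken x L ≡ true) → ∀ X
                  → utility u X ≡ abelSum [] L X
  utility≡abelSum L complete []      = sym (abelSum-[] [] L)
  utility≡abelSum L complete (x ∷ X) =
    trans (cong (u x +_) (utility≡abelSum L complete X)) (sym (abelSum-∷ [] L x X (complete x)))

  gap-nonneg : (∀ o → 0ℚ ≤ u o) → ∀ o L → Linked (λ x y → u y ≤ u x) (o ∷ L)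
             → 0ℚ ≤ gap o L
  gap-nonneg u≥0 o []      _       = p≤q⇒0≤q-p (u≥0 o)
  gap-nonneg u≥0 o (_ ∷ _) (r ∷ _) = p≤q⇒0≤q-p r

  abelSum-mono : (∀ o → 0ℚ ≤ u o) → ∀ acc L {X Z} → Linked (λ x y → u y ≤ u x) L
    → (∀ P R → P ++ R ≡ L → count (acc ++ P) X ℕ.≤ count (acc ++ P) Z)
    → abelSum acc L X ≤ abelSum acc L Z
  abelSum-mono u≥0 acc []      _  _ = ℚ.≤-refl
  abelSum-mono u≥0 acc (o ∷ L) {X} {Z} decreasing dominated =
    ℚ.+-mono-≤ (·-monoˡ-≤ (gap-nonneg u≥0 o L decreasing) (dominated (o ∷ []) L refl))
               (abelSum-mono u≥0 (acc ∷ʳ o) L (Linked.tail decreasing) dominated′)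
    where
    dominated′ : ∀ P R → P ++ R ≡ L → count (acc ∷ʳ o ++ P) X ℕ.≤ count (acc ∷ʳ o ++ P) Z
    dominated′ P R P++R≡L =
      subst (λ A → count A X ℕ.≤ count A Z) (sym (++-assoc acc (o ∷ []) P))
            (dominated (o ∷ P) R (cong (o ∷_) P++R≡L))

  prefix-dominance⇒utility-≤ : ∀ {L} X Z
    → (∀ o → 0ℚ ≤ u o) → Linked (λ x y → u y ≤ u x) L → (∀ o → o ∈ L)
    → (∀ P R → P ++ R ≡ L → count P X ℕ.≤ count P Z)
    → utility u X ≤ utility u Z
  prefix-dominance⇒utility-≤ {L} X Z u≥0 decreasing complete dominated =
    subst₂ _≤_ (sym (utility≡abelSum L complete′ X)) (sym (utility≡abelSum L complete′ Z))
           (abelSum-mono u≥0 [] L decreasing dominated)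
    where
    complete′ : ∀ o → isTaken o L ≡ true
    complete′ o = ∈⇒isTaken (complete o)

ranking-complete : ∀ {m} {σ : List (Fin m)} → IsRanking σ → ∀ o → o ∈ σ
ranking-complete σ↭ o = ∈-resp-↭ (↭-sym σ↭) (∈-allFin o)

theorem2 : ∀ {k m} (π : Vec (Agent k) m)
             (prefs : Fin k → List (Fin m)) → (∀ j → IsRanking (prefs j))
             → (truth : List (Fin m)) → IsRanking truth
             → (u : Fin m → ℚ) → (∀ o → 0ℚ < u o)
             → Linked (λ x y → u y < u x) truth
             → (σ* : List (Fin m)) → Optimal π prefs u σ*
             → value π prefs u σ* ≤ value π prefs u truth + value π prefs u truth
theorem2 π prefs prefs-ranking truth truth-ranking u u>0 decreasing σ* _ = begin
  utility u (bundle π prefs σ*)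
    ≤⟨ prefix-dominance⇒utility-≤ u (bundle π prefs σ*) (truthful ++ truthful)
         u≥0 (Linked.map ℚ.<⇒≤ decreasing) truth-complete dominated ⟩
  utility u (truthful ++ truthful)
    ≡⟨ utility-++ u truthful truthful ⟩
  utility u truthful + utility u truthful
    ∎
  where
  open ℚ.≤-Reasoning
  truthful : List (Fin _)
  truthful = bundle π prefs truth
  u≥0 : ∀ o → 0ℚ ≤ u o
  u≥0 o = ℚ.<⇒≤ (u>0 o)
  truth-complete : ∀ o → o ∈ truth
  truth-complete = ranking-complete truth-ranking
  prefs-complete : ∀ j o → isTaken o (prefs j) ≡ true
  prefs-complete j o = ∈⇒isTaken (ranking-complete (prefs-ranking j) o)
  dominated : ∀ P R → P ++ R ≡ truth
            → count P (bundle π prefs σ*) ℕ.≤ count P (truthful ++ truthful)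
  dominated P R = prefix-count-≤ π prefs prefs-complete σ* P R
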